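{- Let $p$ be a prime, $m\ge 1$ an integer, and $G=\mathbb{Z}_p^m=\bigoplus_{j=1}^m\mathbb{Z}_p$. For every sequence $(g_k)_{k=1}^{p^m}$ of $p^m$ elements of $G$ there is a nonempty subsequence $(g_k)_{k\in K}$ (with $\emptyset\neq K\subseteq\{1,\dots,p^m\}$) such that $\sum_{k\in K}g_k=0_G$ and $\sum_{k\in K}1/|g_k|\le 1$.
   Context: $\mathbb{Z}_p$ denotes the cyclic group of order $p$; $|g|$ denotes the order of an element $g\in G$ and $0_G$ the identity of $G$. Sequences may contain repeated elements. -}

module Defs where

open import Data.Nat using (ℕ; zero; suc; _<_; NonZero)
open import Data.Nat.DivMod using (_mod_)
open import Data.Fin using (Fin; toℕ)
import Data.Fin as F
open import Data.Vec using (Vec; []; _∷_; zipWith; replicate)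
open import Data.Bool using (Bool; true; false)
open import Data.Fin.Subset using (Subset)
open import Data.Product using (_×_)
open import Relation.Binary.PropositionalEquality using (_≡_; _≢_)
open import Data.Rational using (ℚ; 0ℚ; _/_) renaming (_+_ to _+ℚ_)
open import Data.Integer using (+_)
open import Function using (_∘_)

module _ (p : ℕ) .{{_ : NonZero p}} (m : ℕ) where

  G : Set
  G = Vec (Fin p) m

  _+ₚ_ : Fin p → Fin p → Fin p
  a +ₚ b = (toℕ a Data.Nat.+ toℕ b) mod p

  _⊕_ : G → G → G
  _⊕_ = zipWith _+ₚ_

  0G : G
  0G = replicate m (0 mod p)

  _•_ : ℕ → G → G
  zero • g = 0G
  suc n • g = g ⊕ (n • g)

  IsOrder : G → ℕ → Set
  IsOrder g n = (0 < n) × (n • g ≡ 0G) × (∀ k → 0 < k → k < n → k • g ≢ 0G)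

  sumG : ∀ {N} → Subset N → (Fin N → G) → G
  sumG [] f = 0G
  sumG (true ∷ K) f = f F.zero ⊕ sumG K (f ∘ F.suc)
  sumG (false ∷ K) f = sumG K (f ∘ F.suc)

-- 1/n as a rational (n ≥ 1 in all uses; 1/0 := 0 is never used)
recip : ℕ → ℚ
recip zero = 0ℚ
recip (suc n) = (+ 1) / suc n

sumℚ : ∀ {N} → Subset N → (Fin N → ℚ) → ℚ
sumℚ [] f = 0ℚ
sumℚ (true ∷ K) f = f F.zero +ℚ sumℚ K (f ∘ F.suc)
sumℚ (false ∷ K) f = sumℚ K (f ∘ F.suc)

{-# OPTIONS --safe #-}

-- If some g k is 0, the singleton {k} works, since |0| = 1.  Otherwise every g k has order p,
-- and g k = a k · h k, where h k is g k rescaled to have first nonzero coordinate 1 and a k is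
-- that coordinate.  There are only (p^m - 1)/(p - 1) such normalised vectors, one per line
-- through 0, so by pigeonhole some p of the g k lie on a common line h.  Of the p + 1 prefix
-- sums of their coefficients a k, two agree modulo p, so a nonempty block K of at most p of
-- them has p ∣ Σ a k.  Then Σ_{k ∈ K} g k = (Σ a k) · h = 0 and Σ_{k ∈ K} 1/|g k| = |K|/p ≤ 1.

module Submission where

open import Defs
open import Data.Nat using (ℕ; _≤_; _^_; NonZero)
open import Data.Nat.Primality using (Prime)
open import Data.Fin using (Fin)
open import Data.Fin.Subset using (Subset; Nonempty)
open import Data.Product using (Σ; _×_)
open import Relation.Binary.PropositionalEquality using (_≡_)
open import Data.Rational using (1ℚ) renaming (_≤_ to _≤ℚ_)

open import Algebra.Properties.CommutativeSemigroup using (x∙yz≈y∙xz)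
open import Data.Fin using (zero; suc; toℕ; fromℕ<; _≟_)
open import Data.Fin.Properties using (toℕ-fromℕ<; toℕ-injective; toℕ<n; any?; pigeonhole)
open import Data.Fin.Subset using (_∈_; _⊆_; ⊥; ⊤; ⁅_⁆; ∁; _∩_; ∣_∣; inside; outside)
open import Data.Fin.Subset.Properties
  using ( ⊥⊆; ⊆-refl; ⊆-trans; s⊆s; out⊆; p∩q⊆p; x∈p∩q⁻; x∈∁p⇒x∉p; ∩-zeroʳ
        ; nonempty?; Empty-unique; ∣⊥∣≡0; ∣⊤∣≡n; x∈⁅x⁆; x∈⁅y⁆⇒x≡y; ∣⁅x⁆∣≡1)
import Data.Integer as ℤ
import Data.Integer.Properties as ℤ
open import Data.Integer.Tactic.RingSolver using () renaming (solve-∀ to ℤ-solve-∀)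
open import Data.List using (List; []; _∷_; length; map; _++_; cartesianProductWith; allFin)
open import Data.List.Properties using (length-++; length-map; length-tabulate)
open import Data.List.Membership.Propositional using () renaming (_∈_ to _∈ₗ_)
open import Data.List.Membership.Propositional.Properties using (∈-allFin; ∈-map⁺; ∈-++⁺ˡ; ∈-++⁺ʳ)
open import Data.List.Relation.Unary.Any using (here; there)
open import Data.List.Relation.Unary.Any.Properties using (cartesianProductWith⁺)
open import Data.Nat
  using (zero; suc; _+_; _*_; _<_; _%_; s≤s; s≤s⁻¹; z≤n; >-nonZero; >-nonZero⁻¹; nonTrivial⇒n>1)
open import Data.Nat.Coprimality using (Coprime; coprime-Bézout; prime⇒coprime)
import Data.Nat.Coprimality as Coprime
open import Data.Nat.DivMod
  using (_mod_; _/_; m≡m%n+[m/n]*n; m%n%n≡m%n; %-distribˡ-+; %-distribˡ-*; [m+kn]%n≡m%n; m<n⇒m%n≡m)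
open import Data.Nat.Divisibility
  using (_∣_; _∣?_; divides; n∣m*n; ∣m⇒∣m*n; ∣m+n∣m⇒∣n; ∣⇒≤; m%n≡0⇒n∣m; n∣m⇒m%n≡0)
open import Data.Nat.GCD using (module Bézout)
open import Data.Nat.Primality using (euclidsLemma; prime⇒nonTrivial)
open import Data.Nat.Properties
  using ( +-assoc; +-identityʳ; +-cancelˡ-≡; +-cancelˡ-<; +-monoˡ-≤; +-commutativeSemigroup
        ; *-comm; *-assoc; *-suc; *-identityˡ; *-identityʳ; *-zeroʳ; *-distribʳ-+; *-monoʳ-≤
        ; ≤-reflexive; ≤-trans; <-≤-trans; <⇒≤; >⇒≢; ≮⇒≥; m≤n+m; n<1+n; _<?_; module ≤-Reasoning)
open import Data.Nat.Tactic.RingSolver using (solve-∀)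
open import Data.Product using (∃-syntax; ∃₂; _,_; proj₁; proj₂)
open import Data.Rational using (ℚ; toℚᵘ)
open import Data.Rational.Properties using (toℚᵘ-homo-+; toℚᵘ-fromℚᵘ; toℚᵘ-cancel-≤)
import Data.Rational.Unnormalised as ℚᵘ
import Data.Rational.Unnormalised.Properties as ℚᵘ
open import Data.Sum using (inj₁; inj₂)
open import Data.Vec using (Vec; []; _∷_; here; there; lookup; tabulate)
open import Data.Vec.Properties
  using (lookup-zipWith; lookup-replicate; lookup∘tabulate; []=⇒lookup; lookup⇒[]=; ≡-dec)
open import Function using (_∘_; _$_)
open import Relation.Binary.Definitions using (DecidableEquality)
open import Relation.Binary.PropositionalEquality
  using (refl; sym; trans; cong; cong₂; subst₂; _≢_; module ≡-Reasoning)
open import Relation.Nullary using (yes; no; does; contradiction)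
open import Relation.Nullary.Decidable using (dec-true)

sumℕ : ∀ {n} → Subset n → (Fin n → ℕ) → ℕ
sumℕ []            a = 0
sumℕ (inside ∷ K)  a = a zero + sumℕ K (a ∘ suc)
sumℕ (outside ∷ K) a = sumℕ K (a ∘ suc)

sumℕ-zero : ∀ {n} (K : Subset n) → sumℕ K (λ _ → 0) ≡ 0
sumℕ-zero []            = refl
sumℕ-zero (inside ∷ K)  = sumℕ-zero K
sumℕ-zero (outside ∷ K) = sumℕ-zero K

sumℕ-1 : ∀ {n} (K : Subset n) → sumℕ K (λ _ → 1) ≡ ∣ K ∣
sumℕ-1 []            = refl
sumℕ-1 (inside ∷ K)  = cong suc (sumℕ-1 K)
sumℕ-1 (outside ∷ K) = sumℕ-1 K

sumℕ-partition : ∀ {n} (K L : Subset n) a → sumℕ K a ≡ sumℕ (K ∩ L) a + sumℕ (K ∩ ∁ L) a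
sumℕ-partition []            []            a = refl
sumℕ-partition (outside ∷ K) (_ ∷ L)       a = sumℕ-partition K L (a ∘ suc)
sumℕ-partition (inside ∷ K)  (inside ∷ L)  a =
  trans (cong (a zero +_) (sumℕ-partition K L (a ∘ suc))) (sym (+-assoc (a zero) _ _))
sumℕ-partition (inside ∷ K)  (outside ∷ L) a =
  trans (cong (a zero +_) (sumℕ-partition K L (a ∘ suc)))
        (x∙yz≈y∙xz +-commutativeSemigroup (a zero) (sumℕ (K ∩ L) (a ∘ suc)) _)

∣p∣≡∣p∩q∣+∣p∩∁q∣ : ∀ {n} (K L : Subset n) → ∣ K ∣ ≡ ∣ K ∩ L ∣ + ∣ K ∩ ∁ L ∣
∣p∣≡∣p∩q∣+∣p∩∁q∣ K L = begin
  ∣ K ∣                                    ≡⟨ sumℕ-1 K ⟨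
  sumℕ K ones                              ≡⟨ sumℕ-partition K L ones ⟩
  sumℕ (K ∩ L) ones + sumℕ (K ∩ ∁ L) ones  ≡⟨ cong₂ _+_ (sumℕ-1 (K ∩ L)) (sumℕ-1 (K ∩ ∁ L)) ⟩
  ∣ K ∩ L ∣ + ∣ K ∩ ∁ L ∣                  ∎
  where
  open ≡-Reasoning
  ones : Fin _ → ℕ
  ones _ = 1

∣p∣>0⇒nonempty : ∀ {n} {K : Subset n} → 0 < ∣ K ∣ → Nonempty K
∣p∣>0⇒nonempty {n} {K} 0<∣K∣ with nonempty? K
... | yes K≢∅ = K≢∅
... | no  K≡∅ = contradiction (trans (cong ∣_∣ (Empty-unique K≡∅)) (∣⊥∣≡0 n)) (>⇒≢ 0<∣K∣)

-- Zero-sum subsets modulo d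

prefix : ∀ {n} → ℕ → Subset n → Subset n
prefix zero    T             = ⊥
prefix (suc i) []            = []
prefix (suc i) (outside ∷ T) = outside ∷ prefix (suc i) T
prefix (suc i) (inside ∷ T)  = inside ∷ prefix i T

prefix-⊆ : ∀ {n} i (T : Subset n) → prefix i T ⊆ T
prefix-⊆ zero    T             = ⊥⊆
prefix-⊆ (suc i) []            = ⊆-refl
prefix-⊆ (suc i) (outside ∷ T) = out⊆ (prefix-⊆ (suc i) T)
prefix-⊆ (suc i) (inside ∷ T)  = s⊆s (prefix-⊆ i T)

∣prefix∣ : ∀ {n} i (T : Subset n) → i ≤ ∣ T ∣ → ∣ prefix i T ∣ ≡ i
∣prefix∣ {n} zero    T             _           = ∣⊥∣≡0 n
∣prefix∣     (suc i) (outside ∷ T) i<∣T∣       = ∣prefix∣ (suc i) T i<∣T∣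
∣prefix∣     (suc i) (inside ∷ T)  (s≤s i≤∣T∣) = cong suc (∣prefix∣ i T i≤∣T∣)

prefix-∩ : ∀ {n i j} (T : Subset n) → i ≤ j → prefix j T ∩ prefix i T ≡ prefix i T
prefix-∩ {i = zero}  {j}     T             _         = ∩-zeroʳ (prefix j T)
prefix-∩ {i = suc i} {suc j} []            _         = refl
prefix-∩ {i = suc i} {suc j} (outside ∷ T) i≤j       = cong (outside ∷_) (prefix-∩ T i≤j)
prefix-∩ {i = suc i} {suc j} (inside ∷ T)  (s≤s i≤j) = cong (inside ∷_) (prefix-∩ T i≤j)

segment : ∀ {n} → ℕ → ℕ → Subset n → Subset n
segment i j T = prefix j T ∩ ∁ (prefix i T)

segment-⊆ : ∀ {n} i j (T : Subset n) → segment i j T ⊆ T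
segment-⊆ i j T = ⊆-trans (p∩q⊆p _ _) (prefix-⊆ j T)

sumℕ-prefix : ∀ {n i j} (T : Subset n) a → i ≤ j →
  sumℕ (prefix j T) a ≡ sumℕ (prefix i T) a + sumℕ (segment i j T) a
sumℕ-prefix {i = i} {j} T a i≤j = trans (sumℕ-partition (prefix j T) (prefix i T) a)
  (cong (λ L → sumℕ L a + sumℕ (segment i j T) a) (prefix-∩ T i≤j))

∣segment∣ : ∀ {n i j} (T : Subset n) → i ≤ j → j ≤ ∣ T ∣ → i + ∣ segment i j T ∣ ≡ j
∣segment∣ {i = i} {j} T i≤j j≤∣T∣ = begin
  i + ∣ S ∣                            ≡⟨ cong (_+ ∣ S ∣) (∣prefix∣ i T (≤-trans i≤j j≤∣T∣)) ⟨
  ∣ prefix i T ∣ + ∣ S ∣               ≡⟨ cong (λ L → ∣ L ∣ + ∣ S ∣) (prefix-∩ T i≤j) ⟨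
  ∣ prefix j T ∩ prefix i T ∣ + ∣ S ∣  ≡⟨ ∣p∣≡∣p∩q∣+∣p∩∁q∣ (prefix j T) (prefix i T) ⟨
  ∣ prefix j T ∣                       ≡⟨ ∣prefix∣ j T j≤∣T∣ ⟩
  j                                    ∎
  where
  open ≡-Reasoning
  S : Subset _
  S = segment i j T

[m+n]%d≡m%d⇒d∣n : ∀ {d} .{{_ : NonZero d}} m n → (m + n) % d ≡ m % d → d ∣ n
[m+n]%d≡m%d⇒d∣n {d} m n eq = ∣m+n∣m⇒∣n (divides ((m + n) / d) multiple) (n∣m*n (m / d))
  where
  open ≡-Reasoning
  multiple : m / d * d + n ≡ (m + n) / d * d
  multiple = +-cancelˡ-≡ (m % d) _ _ $ begin
    m % d + (m / d * d + n)        ≡⟨ +-assoc (m % d) _ n ⟨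
    m % d + m / d * d + n          ≡⟨ cong (_+ n) (m≡m%n+[m/n]*n m d) ⟨
    m + n                          ≡⟨ m≡m%n+[m/n]*n (m + n) d ⟩
    (m + n) % d + (m + n) / d * d  ≡⟨ cong (_+ (m + n) / d * d) eq ⟩
    m % d + (m + n) / d * d        ∎

zeroSum-subset : ∀ {n} d .{{_ : NonZero d}} (T : Subset n) (a : Fin n → ℕ) → d ≤ ∣ T ∣ →
  ∃[ K ] K ⊆ T × Nonempty K × ∣ K ∣ ≤ d × d ∣ sumℕ K a
zeroSum-subset d T a d≤∣T∣
  with i , j , i<j , same-residue ← pigeonhole (n<1+n d) (λ i → sumℕ (prefix (toℕ i) T) a mod d)
  = segment I J T , segment-⊆ I J T , ∣p∣>0⇒nonempty 0<∣K∣ , ∣K∣≤d , d∣ΣK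
  where
  I J : ℕ
  I = toℕ i
  J = toℕ j
  J≤d : J ≤ d
  J≤d = s≤s⁻¹ (toℕ<n j)
  I+∣K∣≡J : I + ∣ segment I J T ∣ ≡ J
  I+∣K∣≡J = ∣segment∣ T (<⇒≤ i<j) (≤-trans J≤d d≤∣T∣)
  0<∣K∣ : 0 < ∣ segment I J T ∣
  0<∣K∣ = +-cancelˡ-< I 0 _ (subst₂ _<_ (sym (+-identityʳ I)) (sym I+∣K∣≡J) i<j)
  ∣K∣≤d : ∣ segment I J T ∣ ≤ d
  ∣K∣≤d = ≤-trans (m≤n+m _ I) (≤-trans (≤-reflexive I+∣K∣≡J) J≤d)
  d∣ΣK : d ∣ sumℕ (segment I J T) a
  d∣ΣK = [m+n]%d≡m%d⇒d∣n (sumℕ (prefix I T) a) (sumℕ (segment I J T) a) $ begin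
    (sumℕ (prefix I T) a + sumℕ (segment I J T) a) % d  ≡⟨ cong (_% d) (sumℕ-prefix T a (<⇒≤ i<j)) ⟨
    sumℕ (prefix J T) a % d                             ≡⟨ toℕ-fromℕ< _ ⟨
    toℕ (sumℕ (prefix J T) a mod d)                     ≡⟨ cong toℕ same-residue ⟨
    toℕ (sumℕ (prefix I T) a mod d)                     ≡⟨ toℕ-fromℕ< _ ⟩
    sumℕ (prefix I T) a % d                             ∎
    where open ≡-Reasoning

-- Pigeonhole principle for fibres

module _ {B : Set} (_≟ᴮ_ : DecidableEquality B) where

  fibre : ∀ {n} → (Fin n → B) → B → Subset n
  fibre f b = tabulate (λ k → does (f k ≟ᴮ b))

  ∈-fibre⁻ : ∀ {n} {f : Fin n → B} {b k} → k ∈ fibre f b → f k ≡ b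
  ∈-fibre⁻ {f = f} {b} {k} k∈ with f k ≟ᴮ b | trans (sym (lookup∘tabulate _ k)) ([]=⇒lookup k∈)
  ... | yes fk≡b | _  = fk≡b
  ... | no  _    | ()

  ∈-fibre⁺ : ∀ {n} {f : Fin n → B} {b k} → f k ≡ b → k ∈ fibre f b
  ∈-fibre⁺ {f = f} {b} {k} fk≡b =
    lookup⇒[]= k _ (trans (lookup∘tabulate _ k) (dec-true (f k ≟ᴮ b) fk≡b))

  pigeonhole-fibre : ∀ {n} r (f : Fin n → B) (bs : List B) (S : Subset n) →
    (∀ {k} → k ∈ S → f k ∈ₗ bs) → length bs * r < ∣ S ∣ →
    ∃₂ λ b T → (∀ {k} → k ∈ T → f k ≡ b) × r < ∣ T ∣
  pigeonhole-fibre r f [] S covered large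
    with k , k∈S ← ∣p∣>0⇒nonempty large
    with () ← covered k∈S
  pigeonhole-fibre r f (b ∷ bs) S covered large with r <? ∣ S ∩ fibre f b ∣
  ... | yes r<∣S∩F∣ = b , S ∩ fibre f b , ∈-fibre⁻ ∘ proj₂ ∘ x∈p∩q⁻ S _ , r<∣S∩F∣
  ... | no  r≮∣S∩F∣ = pigeonhole-fibre r f bs (S ∩ ∁ (fibre f b)) covered′ large′
    where
    covered′ : ∀ {k} → k ∈ S ∩ ∁ (fibre f b) → f k ∈ₗ bs
    covered′ k∈ with k∈S , k∈∁F ← x∈p∩q⁻ S _ k∈ with covered k∈S
    ... | here  fk≡b  = contradiction (∈-fibre⁺ fk≡b) (x∈∁p⇒x∉p k∈∁F)
    ... | there fk∈bs = fk∈bs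
    large′ : length bs * r < ∣ S ∩ ∁ (fibre f b) ∣
    large′ = +-cancelˡ-< r _ _ $ begin-strict
      r + length bs * r                          <⟨ large ⟩
      ∣ S ∣                                      ≡⟨ ∣p∣≡∣p∩q∣+∣p∩∁q∣ S (fibre f b) ⟩
      ∣ S ∩ fibre f b ∣ + ∣ S ∩ ∁ (fibre f b) ∣  ≤⟨ +-monoˡ-≤ _ (≮⇒≥ r≮∣S∩F∣) ⟩
      r + ∣ S ∩ ∁ (fibre f b) ∣                  ∎
      where open ≤-Reasoning

-- Bounds are proved in ℚᵘ, where fractions with a common denominator add without normalisation.
recip-≤ : ∀ r {o} → suc r ≤ o → toℚᵘ (recip o) ℚᵘ.≤ ℤ.+ 1 ℚᵘ./ suc r
recip-≤ r {suc o} r<o =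
  ℚᵘ.≤-respˡ-≃ (ℚᵘ.≃-sym (toℚᵘ-fromℚᵘ (ℤ.+ 1 ℚᵘ./ suc o))) (ℚᵘ.*≤* (ℤ.+≤+ (*-monoʳ-≤ 1 r<o)))

a/d+b/d≃[a+b]/d : ∀ a b r → ℤ.+ a ℚᵘ./ suc r ℚᵘ.+ ℤ.+ b ℚᵘ./ suc r ℚᵘ.≃ ℤ.+ (a + b) ℚᵘ./ suc r
a/d+b/d≃[a+b]/d a b r = ℚᵘ.*≡* $ trans (ℤ-identity (ℤ.+ a) (ℤ.+ b) (ℤ.+ suc r))
  (sym (cong₂ ℤ._*_ (ℤ.pos-+ a b) (ℤ.pos-* (suc r) (suc r))))
  where
  ℤ-identity : ∀ A B R → (A ℤ.* R ℤ.+ B ℤ.* R) ℤ.* R ≡ (A ℤ.+ B) ℤ.* (R ℤ.* R)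
  ℤ-identity = ℤ-solve-∀

sumℚ-≤ : ∀ {n} r (K : Subset n) (f : Fin n → ℚ) →
  (∀ {k} → k ∈ K → toℚᵘ (f k) ℚᵘ.≤ ℤ.+ 1 ℚᵘ./ suc r) → toℚᵘ (sumℚ K f) ℚᵘ.≤ ℤ.+ ∣ K ∣ ℚᵘ./ suc r
sumℚ-≤ r []            f bounded = ℚᵘ.*≤* (ℤ.+≤+ z≤n)
sumℚ-≤ r (outside ∷ K) f bounded = sumℚ-≤ r K (f ∘ suc) (bounded ∘ there)
sumℚ-≤ r (inside ∷ K)  f bounded =
  ℚᵘ.≤-respˡ-≃ (ℚᵘ.≃-sym (toℚᵘ-homo-+ (f zero) (sumℚ K (f ∘ suc))))
    (ℚᵘ.≤-respʳ-≃ (a/d+b/d≃[a+b]/d 1 ∣ K ∣ r)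
      (ℚᵘ.+-mono-≤ (bounded here) (sumℚ-≤ r K (f ∘ suc) (bounded ∘ there))))

sumℚ-recip≤1 : ∀ {n} r (K : Subset n) (o : Fin n → ℕ) →
  (∀ {k} → k ∈ K → suc r ≤ o k) → ∣ K ∣ ≤ suc r → sumℚ K (λ k → recip (o k)) ≤ℚ 1ℚ
sumℚ-recip≤1 r K o large small = toℚᵘ-cancel-≤ $ ℚᵘ.≤-trans (sumℚ-≤ r K _ (recip-≤ r ∘ large))
  (ℚᵘ.*≤* (subst₂ ℤ._≤_ (sym (ℤ.*-identityʳ _)) (sym (ℤ.*-identityˡ _)) (ℤ.+≤+ small)))

infixr 7 _·_
_·_ : ∀ {n} .{{_ : NonZero n}} {m} → ℕ → G n m → G n m
_·_ {n} {m} = _•_ n m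

module _ {n : ℕ} .{{_ : NonZero n}} where

  0%n≡0 : 0 % n ≡ 0
  0%n≡0 = m<n⇒m%n≡m (>-nonZero⁻¹ n)

  [m+n%d]%d≡[m+n]%d : ∀ a b → (a + b % n) % n ≡ (a + b) % n
  [m+n%d]%d≡[m+n]%d a b = begin
    (a + b % n) % n          ≡⟨ %-distribˡ-+ a (b % n) n ⟩
    (a % n + b % n % n) % n  ≡⟨ cong (λ x → (a % n + x) % n) (m%n%n≡m%n b n) ⟩
    (a % n + b % n) % n      ≡⟨ %-distribˡ-+ a b n ⟨
    (a + b) % n              ∎
    where open ≡-Reasoning

  [m*n%d]%d≡[m*n]%d : ∀ a b → (a * (b % n)) % n ≡ (a * b) % n
  [m*n%d]%d≡[m*n]%d a b = begin
    (a * (b % n)) % n          ≡⟨ %-distribˡ-* a (b % n) n ⟩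
    (a % n * (b % n % n)) % n  ≡⟨ cong (λ x → (a % n * x) % n) (m%n%n≡m%n b n) ⟩
    (a % n * (b % n)) % n      ≡⟨ %-distribˡ-* a b n ⟨
    (a * b) % n                ∎
    where open ≡-Reasoning

  coord : ∀ {m} → G n m → Fin m → ℕ
  coord v j = toℕ (lookup v j)

  coord%n≡coord : ∀ {m} (v : G n m) j → coord v j % n ≡ coord v j
  coord%n≡coord v j = m<n⇒m%n≡m (toℕ<n (lookup v j))

  coord-injective : ∀ {m} {u v : G n m} → (∀ j → coord u j ≡ coord v j) → u ≡ v
  coord-injective {u = []}    {[]}    _  = refl
  coord-injective {u = x ∷ u} {y ∷ v} eq =
    cong₂ _∷_ (toℕ-injective (eq zero)) (coord-injective (eq ∘ suc))

  coord-0G : ∀ {m} (j : Fin m) → coord (0G n m) j ≡ 0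
  coord-0G j = trans (cong toℕ (lookup-replicate j _)) (trans (toℕ-fromℕ< _) 0%n≡0)

  coord-⊕ : ∀ {m} (u v : G n m) j → coord (_⊕_ n m u v) j ≡ (coord u j + coord v j) % n
  coord-⊕ u v j = trans (cong toℕ (lookup-zipWith _ j u v)) (toℕ-fromℕ< _)

  coord-· : ∀ {m} k (v : G n m) j → coord (k · v) j ≡ (k * coord v j) % n
  coord-· zero    v j = trans (coord-0G j) (sym 0%n≡0)
  coord-· (suc k) v j = begin
    coord (_⊕_ n _ v (k · v)) j            ≡⟨ coord-⊕ v (k · v) j ⟩
    (coord v j + coord (k · v) j) % n      ≡⟨ cong (λ x → (coord v j + x) % n) (coord-· k v j) ⟩
    (coord v j + (k * coord v j) % n) % n  ≡⟨ [m+n%d]%d≡[m+n]%d (coord v j) _ ⟩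
    (coord v j + k * coord v j) % n        ∎
    where open ≡-Reasoning

  ·-distribʳ-+ : ∀ {m} a b (h : G n m) → (a + b) · h ≡ _⊕_ n m (a · h) (b · h)
  ·-distribʳ-+ a b h = coord-injective λ j → begin
    coord ((a + b) · h) j                            ≡⟨ coord-· (a + b) h j ⟩
    ((a + b) * coord h j) % n                        ≡⟨ cong (_% n) (*-distribʳ-+ (coord h j) a b) ⟩
    (a * coord h j + b * coord h j) % n              ≡⟨ %-distribˡ-+ (a * coord h j) _ n ⟩
    ((a * coord h j) % n + (b * coord h j) % n) % n  ≡⟨ cong₂ (λ x y → (x + y) % n)
                                                           (coord-· a h j) (coord-· b h j) ⟨
    (coord (a · h) j + coord (b · h) j) % n          ≡⟨ coord-⊕ (a · h) (b · h) j ⟨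
    coord (_⊕_ n _ (a · h) (b · h)) j                ∎
    where open ≡-Reasoning

  ∣⇒·≡0G : ∀ {m k} (h : G n m) → n ∣ k → k · h ≡ 0G n m
  ∣⇒·≡0G {k = k} h n∣k = coord-injective λ j → begin
    coord (k · h) j      ≡⟨ coord-· k h j ⟩
    (k * coord h j) % n  ≡⟨ n∣m⇒m%n≡0 _ n (∣m⇒∣m*n (coord h j) n∣k) ⟩
    0                    ≡⟨ coord-0G j ⟨
    coord (0G n _) j     ∎
    where open ≡-Reasoning

  sumG-· : ∀ {N m} (K : Subset N) (g : Fin N → G n m) (a : Fin N → ℕ) (h : G n m) →
    (∀ {k} → k ∈ K → g k ≡ a k · h) → sumG n m K g ≡ sumℕ K a · h
  sumG-· []            g a h on-line = refl
  sumG-· (outside ∷ K) g a h on-line = sumG-· K (g ∘ suc) (a ∘ suc) h (on-line ∘ there)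
  sumG-· (inside ∷ K)  g a h on-line = trans
    (cong₂ (_⊕_ n _) (on-line here) (sumG-· K (g ∘ suc) (a ∘ suc) h (on-line ∘ there)))
    (sym (·-distribʳ-+ (a zero) (sumℕ K (a ∘ suc)) h))

  sumG-zero : ∀ {N m} (K : Subset N) (g : Fin N → G n m) →
    (∀ {k} → k ∈ K → g k ≡ 0G n m) → sumG n m K g ≡ 0G n m
  sumG-zero K g zero-on-K =
    trans (sumG-· K g (λ _ → 0) (0G n _) zero-on-K) (cong (_· 0G n _) (sumℕ-zero K))

coprime⇒∃inverse : ∀ {a n} .{{_ : NonZero n}} → Coprime a n → ∃[ b ] (a * b) % n ≡ 1 % n
coprime⇒∃inverse {a} {n@(suc r)} coprime with coprime-Bézout coprime
... | Bézout.+- x y 1+yn≡xa = x , (begin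
  (a * x) % n      ≡⟨ cong (_% n) (trans (*-comm a x) (sym 1+yn≡xa)) ⟩
  (1 + y * n) % n  ≡⟨ [m+kn]%n≡m%n 1 y n ⟩
  1 % n            ∎)
  where open ≡-Reasoning
... | Bézout.-+ x y 1+xa≡yn = x * r , (begin
  (a * (x * r)) % n                ≡⟨ [m+kn]%n≡m%n (a * (x * r)) y n ⟨
  (a * (x * r) + y * n) % n        ≡⟨ cong (λ z → (a * (x * r) + z) % n) 1+xa≡yn ⟨
  (a * (x * r) + (1 + x * a)) % n  ≡⟨ cong (_% n) (rearrange a x r) ⟩
  (1 + (x * a) * n) % n            ≡⟨ [m+kn]%n≡m%n 1 (x * a) n ⟩
  1 % n                            ∎)
  where
  open ≡-Reasoning
  rearrange : ∀ a x r → a * (x * r) + (1 + x * a) ≡ 1 + (x * a) * suc r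
  rearrange = solve-∀

length-cartesianProductWith : ∀ {A B C : Set} (f : A → B → C) (xs : List A) (ys : List B) →
  length (cartesianProductWith f xs ys) ≡ length xs * length ys
length-cartesianProductWith f []       ys = refl
length-cartesianProductWith f (x ∷ xs) ys = trans (length-++ (map (f x) ys))
  (cong₂ _+_ (length-map (f x) ys) (length-cartesianProductWith f xs ys))

vectors : ∀ {n} m → List (Vec (Fin n) m)
vectors zero    = [] ∷ []
vectors (suc m) = cartesianProductWith _∷_ (allFin _) (vectors m)

length-vectors : ∀ n m → length (vectors {n} m) ≡ n ^ m
length-vectors n zero    = refl
length-vectors n (suc m) = trans (length-cartesianProductWith _∷_ (allFin n) (vectors m))
  (cong₂ _*_ (length-tabulate {n = n} (λ i → i)) (length-vectors n m))

∈-vectors : ∀ {n m} (v : Vec (Fin n) m) → v ∈ₗ vectors m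
∈-vectors []      = here refl
∈-vectors (x ∷ v) = cartesianProductWith⁺ _∷_ (cong₂ _∷_) (∈-allFin x) (∈-vectors v)

-- Orders and lines in ℤ_p^m for prime p

module _ {q : ℕ} (p-prime : Prime (suc q)) where

  private
    p : ℕ
    p = suc q

  ·≡0G⇒∣ : ∀ {m k} (v : G p m) → k · v ≡ 0G p m → v ≢ 0G p m → p ∣ k
  ·≡0G⇒∣ {k = k} v kv≡0 v≢0 with p ∣? k
  ... | yes p∣k = p∣k
  ... | no  p∤k = contradiction (coord-injective λ j → trans (coord≡0 j) (sym (coord-0G j))) v≢0
    where
    p∣k*coord : ∀ j → p ∣ k * coord v j
    p∣k*coord j = m%n≡0⇒n∣m _ p $ begin
      (k * coord v j) % p  ≡⟨ coord-· k v j ⟨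
      coord (k · v) j      ≡⟨ cong (λ w → coord w j) kv≡0 ⟩
      coord (0G p _) j     ≡⟨ coord-0G j ⟩
      0                    ∎
      where open ≡-Reasoning
    coord≡0 : ∀ j → coord v j ≡ 0
    coord≡0 j with euclidsLemma k (coord v j) p-prime (p∣k*coord j)
    ... | inj₁ p∣k     = contradiction p∣k p∤k
    ... | inj₂ p∣coord = trans (sym (coord%n≡coord v j)) (n∣m⇒m%n≡0 _ p p∣coord)

  order≥p : ∀ {m o} {v : G p m} → IsOrder p m v o → v ≢ 0G p m → p ≤ o
  order≥p {v = v} (0<o , ov≡0 , _) v≢0 = ∣⇒≤ {{>-nonZero 0<o}} (·≡0G⇒∣ v ov≡0 v≢0)

  nonzero-coprime : (c : Fin q) → Coprime (toℕ (suc c)) p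
  nonzero-coprime c = Coprime.sym (prime⇒coprime p-prime (toℕ<n (suc c)))

  -- c : Fin q stands for the nonzero residue suc c of ℤ_p.
  _⁻¹ : Fin q → ℕ
  c ⁻¹ = proj₁ (coprime⇒∃inverse (nonzero-coprime c))

  ⁻¹-cancel : ∀ (c : Fin q) x → (toℕ (suc c) * ((c ⁻¹ * x) % p)) % p ≡ x % p
  ⁻¹-cancel c x = begin
    (C * ((c ⁻¹ * x) % p)) % p      ≡⟨ [m*n%d]%d≡[m*n]%d C (c ⁻¹ * x) ⟩
    (C * (c ⁻¹ * x)) % p            ≡⟨ cong (_% p) (*-assoc C (c ⁻¹) x) ⟨
    (C * c ⁻¹ * x) % p              ≡⟨ %-distribˡ-* (C * c ⁻¹) x p ⟩
    ((C * c ⁻¹) % p * (x % p)) % p  ≡⟨ cong (λ y → (y * (x % p)) % p)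
                                           (proj₂ (coprime⇒∃inverse (nonzero-coprime c))) ⟩
    (1 % p * (x % p)) % p           ≡⟨ %-distribˡ-* 1 x p ⟨
    (1 * x) % p                     ≡⟨ cong (_% p) (*-identityˡ x) ⟩
    x % p                           ∎
    where
    open ≡-Reasoning
    C : ℕ
    C = toℕ (suc c)

  1<p : 1 < p
  1<p = nonTrivial⇒n>1 p {{prime⇒nonTrivial p-prime}}

  one : Fin p
  one = fromℕ< 1<p

  leading : ∀ {m} → G p m → ℕ
  leading []          = 0
  leading (zero ∷ v)  = leading v
  leading (suc c ∷ v) = toℕ (suc c)

  normalize : ∀ {m} → G p m → G p m
  normalize []          = []
  normalize (zero ∷ v)  = zero ∷ normalize v
  normalize (suc c ∷ v) = one ∷ c ⁻¹ · v

  coord-normalize : ∀ {m} (v : G p m) j → coord v j ≡ (leading v * coord (normalize v) j) % p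
  coord-normalize (zero ∷ v)  zero    = cong (_% p) (sym (*-zeroʳ (leading v)))
  coord-normalize (zero ∷ v)  (suc j) = coord-normalize v j
  coord-normalize (suc c ∷ v) zero    = sym $ begin
    (toℕ (suc c) * toℕ one) % p  ≡⟨ cong (λ y → (toℕ (suc c) * y) % p) (toℕ-fromℕ< 1<p) ⟩
    (toℕ (suc c) * 1) % p        ≡⟨ cong (_% p) (*-identityʳ (toℕ (suc c))) ⟩
    toℕ (suc c) % p              ≡⟨ coord%n≡coord (suc c ∷ v) zero ⟩
    toℕ (suc c)                  ∎
    where open ≡-Reasoning
  coord-normalize (suc c ∷ v) (suc j) = sym $ begin
    (toℕ (suc c) * coord (c ⁻¹ · v) j) % p        ≡⟨ cong (λ y → (toℕ (suc c) * y) % p)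
                                                         (coord-· (c ⁻¹) v j) ⟩
    (toℕ (suc c) * ((c ⁻¹ * coord v j) % p)) % p  ≡⟨ ⁻¹-cancel c (coord v j) ⟩
    coord v j % p                                 ≡⟨ coord%n≡coord v j ⟩
    coord v j                                     ∎
    where open ≡-Reasoning

  leading·normalize : ∀ {m} (v : G p m) → v ≡ leading v · normalize v
  leading·normalize v = coord-injective λ j →
    trans (coord-normalize v j) (sym (coord-· (leading v) (normalize v) j))

  lines : ∀ m → List (G p m)
  lines zero    = []
  lines (suc m) = map (one ∷_) (vectors m) ++ map (zero ∷_) (lines m)

  length-lines : ∀ m → suc (length (lines m) * q) ≡ p ^ m
  length-lines zero    = refl
  length-lines (suc m) = begin
    suc (length (lines (suc m)) * q)        ≡⟨ cong (λ l → suc (l * q)) length-lines-suc ⟩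
    suc ((p ^ m + length (lines m)) * q)    ≡⟨ rearrange (p ^ m) (length (lines m)) q ⟩
    suc (length (lines m) * q) + p ^ m * q  ≡⟨ cong (_+ p ^ m * q) (length-lines m) ⟩
    p ^ m + p ^ m * q                       ≡⟨ *-suc (p ^ m) q ⟨
    p ^ m * p                               ≡⟨ *-comm (p ^ m) p ⟩
    p * p ^ m                               ∎
    where
    open ≡-Reasoning
    length-lines-suc : length (lines (suc m)) ≡ p ^ m + length (lines m)
    length-lines-suc = trans (length-++ (map (one ∷_) (vectors m)))
      (cong₂ _+_ (trans (length-map _ (vectors m)) (length-vectors p m)) (length-map _ (lines m)))
    rearrange : ∀ a l q → suc ((a + l) * q) ≡ suc (l * q) + a * q
    rearrange = solve-∀

  normalize-∈-lines : ∀ {m} (v : G p m) → v ≢ 0G p m → normalize v ∈ₗ lines m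
  normalize-∈-lines []          v≢0 = contradiction refl v≢0
  normalize-∈-lines (zero ∷ v)  v≢0 = ∈-++⁺ʳ (map (one ∷_) (vectors _))
    (∈-map⁺ (zero ∷_) (normalize-∈-lines v (v≢0 ∘ cong (zero ∷_))))
  normalize-∈-lines (suc c ∷ v) _   = ∈-++⁺ˡ (∈-map⁺ (one ∷_) (∈-vectors (c ⁻¹ · v)))

lemma4 : (p m : ℕ) .{{_ : NonZero p}} → Prime p → 1 ≤ m →
    (g : Fin (p ^ m) → G p m) →
    (o : Fin (p ^ m) → ℕ) → (∀ k → IsOrder p m (g k) (o k)) →
    Σ (Subset (p ^ m)) (λ K →
      Nonempty K × (sumG p m K g ≡ 0G p m) × (sumℚ K (λ k → recip (o k)) ≤ℚ 1ℚ))
lemma4 (suc q) m p-prime _ g o isOrder with any? (λ k → ≡-dec _≟_ (g k) (0G _ m))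
... | yes (k , gk≡0) =
  ⁅ k ⁆ , (k , x∈⁅x⁆ k) , sumG-zero ⁅ k ⁆ g (λ k′∈⁅k⁆ → trans (cong g (x∈⁅y⁆⇒x≡y k k′∈⁅k⁆)) gk≡0) ,
  sumℚ-recip≤1 0 ⁅ k ⁆ o (λ _ → proj₁ (isOrder _)) (≤-reflexive (∣⁅x⁆∣≡1 k))
... | no nonzero
  with h , T , on-h , p≤∣T∣ ←
         pigeonhole-fibre (≡-dec _≟_) q (normalize p-prime ∘ g) (lines p-prime m) ⊤
           (λ {k} _ → normalize-∈-lines p-prime (g k) (nonzero ∘ (k ,_)))
           (≤-reflexive (trans (length-lines p-prime m) (sym (∣⊤∣≡n _))))
  with K , K⊆T , K≢∅ , ∣K∣≤p , p∣ΣK ← zeroSum-subset (suc q) T (leading p-prime ∘ g) p≤∣T∣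
  = K , K≢∅ , trans (sumG-· K g (leading p-prime ∘ g) h on-line) (∣⇒·≡0G h p∣ΣK) ,
    sumℚ-recip≤1 q K o (λ {k} _ → order≥p p-prime (isOrder k) (nonzero ∘ (k ,_))) ∣K∣≤p
  where
  on-line : ∀ {k} → k ∈ K → g k ≡ leading p-prime (g k) · h
  on-line {k} k∈K =
    trans (leading·normalize p-prime (g k)) (cong (leading p-prime (g k) ·_) (on-h (K⊆T k∈K)))
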